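{- Let $S=\{0,\ldots,p-1\}$, $m=L+1+R\ge 1$ with $L,R\ge 0$, $f:S^m\to S$, and let $\tau:S^{\mathbb Z}\to S^{\mathbb Z}$ be the global map $\tau(c)_i=f(c_{i-L},\ldots,c_{i+R})$. Then $\tau$ is injective if and only if there exist neither replaceable local configurations nor periodic local configurations for $f$.
   Context: For a finite word $x=x_1\cdots x_n$ with $n\ge m$, its successor under $f$ is $f(x)=y_1\cdots y_{n-m+1}$ with $y_i=f(x_i\cdots x_{i+m-1})$; $\mathrm{left}_k(x)=x_1\cdots x_k$, $\mathrm{right}_k(x)=x_{n-k+1}\cdots x_n$. Finite words $\alpha,\beta$ are replaceable local configurations if each has length at least $2m-1$, $\alpha\ne\beta$, $\mathrm{left}_{m-1}(\alpha)=\mathrm{left}_{m-1}(\beta)$, $\mathrm{right}_{m-1}(\alpha)=\mathrm{right}_{m-1}(\beta)$, and $\alpha,\beta$ have the same successor under $f$. Finite words $\alpha,\beta$ are periodic local configurations if each has length at least $m$, $\alpha\ne\beta$, $\mathrm{left}_{m-1}(\alpha)=\mathrm{right}_{m-1}(\alpha)$, $\mathrm{left}_{m-1}(\beta)=\mathrm{right}_{m-1}(\beta)$, and $\alpha,\beta$ have the same successor under $f$. -}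

module Defs where

open import Data.Nat using (ℕ; zero; suc; _+_; _∸_; _*_; _≤_)
open import Data.Fin using (Fin; toℕ)
open import Data.Integer as ℤ using (ℤ)
open import Data.List using (List; []; _∷_; length; take; drop; map)
open import Data.Vec using (Vec; tabulate)
import Data.Vec as V
open import Data.Maybe using (Maybe; just; nothing)
import Data.Maybe as M
open import Data.Product using (Σ; _×_; ∃₂)
open import Relation.Binary.PropositionalEquality using (_≡_; _≢_)

Config : ℕ → Set
Config p = ℤ → Fin p

τ : {p : ℕ} (L R : ℕ) → (Vec (Fin p) (L + 1 + R) → Fin p) → Config p → Config p
τ L R f c i = f (tabulate (λ k → c ((i ℤ.- ℤ.+ L) ℤ.+ ℤ.+ toℕ k)))

InjectiveGlobal : {p : ℕ} (L R : ℕ) → (Vec (Fin p) (L + 1 + R) → Fin p) → Set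
InjectiveGlobal {p} L R f =
  (c d : Config p) → (∀ i → τ L R f c i ≡ τ L R f d i) → ∀ i → c i ≡ d i

takeV : {A : Set} (m : ℕ) → List A → Maybe (Vec A m)
takeV zero _ = just V.[]
takeV (suc m) [] = nothing
takeV (suc m) (a ∷ xs) = M.map (a V.∷_) (takeV m xs)

windows : {A : Set} (m : ℕ) → List A → List (Vec A m)
windows m [] = []
windows m (a ∷ xs) with takeV m (a ∷ xs)
... | just v = v ∷ windows m xs
... | nothing = []

successor : {A : Set} {m : ℕ} → (Vec A m → A) → List A → List A
successor {m = m} f x = map f (windows m x)

left : {A : Set} → ℕ → List A → List A
left k x = take k x

right : {A : Set} → ℕ → List A → List A
right k x = drop (length x ∸ k) x

module _ {p : ℕ} {m : ℕ} (f : Vec (Fin p) m → Fin p) where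

  Replaceable : List (Fin p) → List (Fin p) → Set
  Replaceable α β =
    (2 * m ∸ 1 ≤ length α) × (2 * m ∸ 1 ≤ length β) × (α ≢ β)
    × (left (m ∸ 1) α ≡ left (m ∸ 1) β) × (right (m ∸ 1) α ≡ right (m ∸ 1) β)
    × (successor f α ≡ successor f β)

  Periodic : List (Fin p) → List (Fin p) → Set
  Periodic α β =
    (m ≤ length α) × (m ≤ length β) × (α ≢ β)
    × (left (m ∸ 1) α ≡ right (m ∸ 1) α) × (left (m ∸ 1) β ≡ right (m ∸ 1) β)
    × (successor f α ≡ successor f β)

  HasReplaceable : Set
  HasReplaceable = ∃₂ Replaceable

  HasPeriodic : Set
  HasPeriodic = ∃₂ Periodic

-- Reindexing, τ is injective iff equal images under c ↦ (i ↦ f (c i, …, c (i + m - 1)))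
-- force equal configurations. A replaceable pair α, β pasted into a constant background, or a
-- periodic pair repeated with period |α| - (m - 1), gives two distinct configurations with
-- equal images. Conversely, let c and d have equal images. Among the pairs of (m - 1)-blocks of
-- c and d at N + 1 consecutive positions, N = p ^ (m - 1) * p ^ (m - 1), two coincide, and the
-- words of c and d between them form a periodic pair unless they are equal; so the blocks of c
-- and d agree somewhere in every N + 1 consecutive positions. Between such agreements on either
-- side of a position i, the words of c and d have the same successor and the same borders, so
-- they form a replaceable pair unless they are equal; hence c i = d i.
module Submission where

open import Defs
open import Data.Nat using (ℕ; zero; suc; _+_; _∸_; _*_; _^_; _%_; _/_; _≤_; _<_; z≤n; s≤s; _≤?_; NonZero)
open import Data.Nat.Properties
open import Data.Nat.DivMod using (m≡m%n+[m/n]*n; [m+kn]%n≡m%n; %-distribˡ-+; m%n%n≡m%n; m%n<n)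
open import Data.Nat.Tactic.RingSolver using (solve-∀)
open import Data.Integer as ℤ using (ℤ; +_; -[1+_])
import Data.Integer.Properties as ℤP
import Data.Integer.Tactic.RingSolver as ℤRing
open import Data.Fin as Fin using (Fin; toℕ; combine)
import Data.Fin.Properties as FinP
open import Data.List using (List; []; _∷_; length; take; drop; map; applyUpTo)
open import Data.List.Properties using (length-applyUpTo; map-applyUpTo; ∷-injectiveˡ; ∷-injectiveʳ; ≡-dec)
open import Data.Vec using (Vec; tabulate)
open import Data.Vec.Properties using (tabulate-cong)
open import Data.Maybe using (just; nothing)
open import Data.Product using (∃; _×_; _,_)
open import Function using (_∘_)
open import Function.Bundles using (_⇔_; mk⇔)
import Function.Properties.Equivalence as ⇔
open import Relation.Nullary using (¬_; yes; no; contradiction)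
open import Relation.Nullary.Decidable using (decidable-stable)
open import Relation.Binary.PropositionalEquality
open ≡-Reasoning

-- Words as initial segments of sequences

module _ {A : Set} where

  shift : ℕ → (ℕ → A) → ℕ → A
  shift a g t = g (a + t)

  window : {m : ℕ} → (ℕ → A) → ℕ → Vec A m
  window g a = tabulate (λ q → g (a + toℕ q))

  window-shift : ∀ {m} (g : ℕ → A) a b → window {m} (shift a g) b ≡ window g (a + b)
  window-shift g a b = tabulate-cong (λ q → cong g (sym (+-assoc a b (toℕ q))))

  lookupOr : A → List A → ℕ → A
  lookupOr d []       _       = d
  lookupOr d (x ∷ xs) zero    = x
  lookupOr d (x ∷ xs) (suc t) = lookupOr d xs t

  applyUpTo-cong : ∀ {g h : ℕ → A} n → (∀ {t} → t < n → g t ≡ h t) →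
    applyUpTo g n ≡ applyUpTo h n
  applyUpTo-cong zero    _  = refl
  applyUpTo-cong (suc n) eq = cong₂ _∷_ (eq (s≤s z≤n)) (applyUpTo-cong n (eq ∘ s≤s))

  applyUpTo-≡⇒ : ∀ {g h : ℕ → A} {n} → applyUpTo g n ≡ applyUpTo h n →
    ∀ {t} → t < n → g t ≡ h t
  applyUpTo-≡⇒ {n = suc n} eq {zero}  _         = ∷-injectiveˡ eq
  applyUpTo-≡⇒ {n = suc n} eq {suc t} (s≤s t<n) = applyUpTo-≡⇒ (∷-injectiveʳ eq) t<n

  applyUpTo-lookupOr : ∀ d (xs : List A) {n} → length xs ≡ n → applyUpTo (lookupOr d xs) n ≡ xs
  applyUpTo-lookupOr d []       refl = refl
  applyUpTo-lookupOr d (x ∷ xs) refl = cong (x ∷_) (applyUpTo-lookupOr d xs refl)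

  lookupOr-injective : ∀ d (xs ys : List A) {n} → length xs ≡ n → length ys ≡ n →
    (∀ {t} → t < n → lookupOr d xs t ≡ lookupOr d ys t) → xs ≡ ys
  lookupOr-injective d xs ys {n} lxs lys eq = begin
    xs                       ≡⟨ applyUpTo-lookupOr d xs lxs ⟨
    applyUpTo (lookupOr d xs) n ≡⟨ applyUpTo-cong n eq ⟩
    applyUpTo (lookupOr d ys) n ≡⟨ applyUpTo-lookupOr d ys lys ⟩
    ys                       ∎

  lookupOr-take : ∀ d (xs : List A) {k t} → t < k → lookupOr d (take k xs) t ≡ lookupOr d xs t
  lookupOr-take d []       {suc k} _         = refl
  lookupOr-take d (x ∷ xs) {suc k} {zero}  _ = refl
  lookupOr-take d (x ∷ xs) {suc k} {suc t} (s≤s t<k) = lookupOr-take d xs t<k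

  lookupOr-drop : ∀ d (xs : List A) k u → lookupOr d (drop k xs) u ≡ lookupOr d xs (k + u)
  lookupOr-drop d xs       zero    u = refl
  lookupOr-drop d []       (suc k) u = refl
  lookupOr-drop d (x ∷ xs) (suc k) u = lookupOr-drop d xs k u

  take-applyUpTo : ∀ (g : ℕ → A) {k n} → k ≤ n → take k (applyUpTo g n) ≡ applyUpTo g k
  take-applyUpTo g z≤n       = refl
  take-applyUpTo g (s≤s k≤n) = cong (g 0 ∷_) (take-applyUpTo (g ∘ suc) k≤n)

  drop-applyUpTo : ∀ (g : ℕ → A) k n → drop k (applyUpTo g (k + n)) ≡ applyUpTo (shift k g) n
  drop-applyUpTo g zero    n = refl
  drop-applyUpTo g (suc k) n = drop-applyUpTo (g ∘ suc) k n

  right≡drop : ∀ (xs : List A) K {M} → length xs ≡ K + M → right M xs ≡ drop K xs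
  right≡drop xs K {M} eq = trans (cong (λ n → drop (n ∸ M) xs) eq) (cong (λ n → drop n xs) (m+n∸n≡m K M))

  left-applyUpTo : ∀ (g : ℕ → A) K {M} → left M (applyUpTo g (K + M)) ≡ applyUpTo g M
  left-applyUpTo g K {M} = take-applyUpTo g (m≤n+m M K)

  right-applyUpTo : ∀ (g : ℕ → A) K {M} → right M (applyUpTo g (K + M)) ≡ applyUpTo (shift K g) M
  right-applyUpTo g K {M} =
    trans (right≡drop (applyUpTo g (K + M)) K (length-applyUpTo g (K + M))) (drop-applyUpTo g K M)

  takeV-applyUpTo : ∀ (g : ℕ → A) {m n} → m ≤ n → takeV m (applyUpTo g n) ≡ just (window g 0)
  takeV-applyUpTo g z≤n = refl
  takeV-applyUpTo g (s≤s m≤n) rewrite takeV-applyUpTo (g ∘ suc) m≤n = refl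

  takeV-short : ∀ m (xs : List A) → length xs < m → takeV m xs ≡ nothing
  takeV-short (suc m) []       _ = refl
  takeV-short (suc m) (x ∷ xs) (s≤s lt) rewrite takeV-short m xs lt = refl

  windows-short : ∀ m (xs : List A) → length xs < m → windows m xs ≡ []
  windows-short m []       _ = refl
  windows-short m (x ∷ xs) lt with takeV m (x ∷ xs) | takeV-short m (x ∷ xs) lt
  ... | nothing | _ = refl

  windows-∷ : ∀ m x (xs : List A) {v} → takeV m (x ∷ xs) ≡ just v →
    windows m (x ∷ xs) ≡ v ∷ windows m xs
  windows-∷ m x xs eq with takeV m (x ∷ xs)
  windows-∷ m x xs refl | just _ = refl

  windows-applyUpTo : ∀ (g : ℕ → A) K M →
    windows (suc M) (applyUpTo g (K + M)) ≡ applyUpTo (window g) K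
  windows-applyUpTo g zero M =
    windows-short (suc M) (applyUpTo g M) (s≤s (≤-reflexive (length-applyUpTo g M)))
  windows-applyUpTo g (suc K) M = begin
    windows (suc M) (g 0 ∷ applyUpTo (g ∘ suc) (K + M))
      ≡⟨ windows-∷ (suc M) (g 0) _ (takeV-applyUpTo g (s≤s (m≤n+m M K))) ⟩
    window g 0 ∷ windows (suc M) (applyUpTo (g ∘ suc) (K + M))
      ≡⟨ cong (window g 0 ∷_) (windows-applyUpTo (g ∘ suc) K M) ⟩
    window g 0 ∷ applyUpTo (window (g ∘ suc)) K
      ∎

  successor-applyUpTo : ∀ {M} (f : Vec A (suc M) → A) (g : ℕ → A) K →
    successor f (applyUpTo g (K + M)) ≡ applyUpTo (f ∘ window g) K
  successor-applyUpTo {M} f g K =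
    trans (cong (map f) (windows-applyUpTo g K M)) (map-applyUpTo (window g) f K)

windowℤ : {A : Set} {m : ℕ} → (ℤ → A) → ℤ → Vec A m
windowℤ c s = tabulate (λ q → c (s ℤ.+ + toℕ q))

WindowInjective : {A : Set} {m : ℕ} → (Vec A m → A) → Set
WindowInjective {A} f =
  (c d : ℤ → A) → (∀ s → f (windowℤ c s) ≡ f (windowℤ d s)) → ∀ i → c i ≡ d i

injectiveGlobal⇔windowInjective : ∀ {p} L R (f : Vec (Fin p) (L + 1 + R) → Fin p) →
  InjectiveGlobal L R f ⇔ WindowInjective f
injectiveGlobal⇔windowInjective L R f = mk⇔
  (λ inj c d same → inj c d (λ i → same (i ℤ.- + L)))
  (λ inj c d same → inj c d (λ s →
    subst (λ j → f (windowℤ c j) ≡ f (windowℤ d j)) (i+n-n≡i s (+ L)) (same (s ℤ.+ + L))))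
  where
  i+n-n≡i : ∀ i n → i ℤ.+ n ℤ.- n ≡ i
  i+n-n≡i = ℤRing.solve-∀

windowℤ-restrict : ∀ {A : Set} {m} (c : ℤ → A) z a →
  window {m = m} (λ n → c (z ℤ.+ + n)) a ≡ windowℤ c (z ℤ.+ + a)
windowℤ-restrict c z a = tabulate-cong (λ q → cong c (sym (ℤP.+-assoc z (+ a) (+ toℕ q))))

i+n≡+m⇒i≡+[m∸n] : ∀ {i n m} → i ℤ.+ + n ≡ + m → n ≤ m → i ≡ + (m ∸ n)
i+n≡+m⇒i≡+[m∸n] {i} {n} {m} eq n≤m = begin
  i                 ≡⟨ i≡i+n-n i (+ n) ⟩
  i ℤ.+ + n ℤ.- + n ≡⟨ cong (ℤ._- + n) eq ⟩
  + m ℤ.- + n       ≡⟨ ℤP.m-n≡m⊖n m n ⟩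
  m ℤ.⊖ n           ≡⟨ ℤP.⊖-≥ n≤m ⟩
  + (m ∸ n)         ∎
  where
  i≡i+n-n : ∀ i n → i ≡ i ℤ.+ n ℤ.- n
  i≡i+n-n = ℤRing.solve-∀

-- A natural number congruent to i modulo suc k.
ℕrep : ℕ → ℤ → ℕ
ℕrep k (+ n)    = n
ℕrep k -[1+ n ] = k * suc n

wraps : ℤ → ℕ
wraps (+ n)    = 0
wraps -[1+ n ] = suc n

+ℕrep : ∀ k i → + ℕrep k i ≡ i ℤ.+ + (wraps i * suc k)
+ℕrep k (+ n)    = cong +_ (sym (+-identityʳ n))
+ℕrep k -[1+ n ] = begin
  + (k * suc n)                            ≡⟨ ℤP.pos-* k (suc n) ⟩
  + k ℤ.* + suc n                          ≡⟨ xy≡-y+y[1+x] (+ k) (+ suc n) ⟩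
  ℤ.- + suc n ℤ.+ + suc n ℤ.* + suc k      ≡⟨ cong (λ z → -[1+ n ] ℤ.+ z) (ℤP.pos-* (suc n) (suc k)) ⟨
  -[1+ n ] ℤ.+ + (suc n * suc k)           ∎
  where
  xy≡-y+y[1+x] : ∀ x y → x ℤ.* y ≡ ℤ.- y ℤ.+ y ℤ.* (ℤ.1ℤ ℤ.+ x)
  xy≡-y+y[1+x] = ℤRing.solve-∀

ℕrep-+ : ∀ k s q → ℕrep k (s ℤ.+ + q) % suc k ≡ (ℕrep k s + q) % suc k
ℕrep-+ k s q = begin
  a % K                   ≡⟨ [m+kn]%n≡m%n a (wraps s) K ⟨
  (a + wraps s * K) % K   ≡⟨ cong (_% K) (ℤP.+-injective lift) ⟩
  (b + q + wraps (s ℤ.+ + q) * K) % K ≡⟨ [m+kn]%n≡m%n (b + q) (wraps (s ℤ.+ + q)) K ⟩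
  (b + q) % K             ∎
  where
  K = suc k
  a = ℕrep k (s ℤ.+ + q)
  b = ℕrep k s
  rearrange : ∀ s q x y → s ℤ.+ q ℤ.+ x ℤ.+ y ≡ s ℤ.+ y ℤ.+ q ℤ.+ x
  rearrange = ℤRing.solve-∀
  lift : + a ℤ.+ + (wraps s * K) ≡ + b ℤ.+ + q ℤ.+ + (wraps (s ℤ.+ + q) * K)
  lift = begin
    + a ℤ.+ + (wraps s * K) ≡⟨ cong (ℤ._+ + (wraps s * K)) (+ℕrep k (s ℤ.+ + q)) ⟩
    s ℤ.+ + q ℤ.+ + (wraps (s ℤ.+ + q) * K) ℤ.+ + (wraps s * K) ≡⟨ rearrange s (+ q) _ _ ⟩
    s ℤ.+ + (wraps s * K) ℤ.+ + q ℤ.+ + (wraps (s ℤ.+ + q) * K)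
      ≡⟨ cong (λ z → z ℤ.+ + q ℤ.+ + (wraps (s ℤ.+ + q) * K)) (+ℕrep k s) ⟨
    + b ℤ.+ + q ℤ.+ + (wraps (s ℤ.+ + q) * K) ∎

[m%n+o]%n≡[m+o]%n : ∀ m n o .{{_ : NonZero n}} → (m % n + o) % n ≡ (m + o) % n
[m%n+o]%n≡[m+o]%n m n o = begin
  (m % n + o) % n         ≡⟨ %-distribˡ-+ (m % n) o n ⟩
  (m % n % n + o % n) % n ≡⟨ cong (λ x → (x + o % n) % n) (m%n%n≡m%n m n) ⟩
  (m % n + o % n) % n     ≡⟨ %-distribˡ-+ m o n ⟨
  (m + o) % n             ∎

module _ {A : Set} where

  pad : A → (ℕ → A) → ℤ → A
  pad d g (+ n)    = g n
  pad d g -[1+ _ ] = d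

  extendPeriodically : ℕ → (ℕ → A) → ℤ → A
  extendPeriodically k g i = g (ℕrep k i % suc k)

  periodic-mod : ∀ {K M} .{{_ : NonZero K}} {g : ℕ → A} → (∀ {u} → u < M → g u ≡ g (K + u)) →
    ∀ {t} → t < K + M → g (t % K) ≡ g t
  periodic-mod {K} {M} {g} period {t} t< = begin
    g (t % K)             ≡⟨ periodic-shift (t / K) (t % K) (subst (_< K + M) (m≡m%n+[m/n]*n t K) t<) ⟨
    g (t % K + t / K * K) ≡⟨ cong g (m≡m%n+[m/n]*n t K) ⟨
    g t                   ∎
    where
    swap : ∀ r K x → r + (K + x) ≡ K + (r + x)
    swap = solve-∀
    periodic-shift : ∀ j r → r + j * K < K + M → g (r + j * K) ≡ g r
    periodic-shift zero    r _  = cong g (+-identityʳ r)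
    periodic-shift (suc j) r lt = begin
      g (r + (K + j * K)) ≡⟨ cong g (swap r K (j * K)) ⟩
      g (K + (r + j * K)) ≡⟨ period r+jK<M ⟨
      g (r + j * K)       ≡⟨ periodic-shift j r (<-≤-trans r+jK<M (m≤n+m M K)) ⟩
      g r                 ∎
      where
      r+jK<M : r + j * K < M
      r+jK<M = +-cancelˡ-< K (r + j * K) M (subst (_< K + M) (swap r K (j * K)) lt)

  windowℤ-extendPeriodically : ∀ {M k} {g : ℕ → A} → (∀ {u} → u < M → g u ≡ g (suc k + u)) →
    ∀ s → windowℤ {m = suc M} (extendPeriodically k g) s ≡ window g (ℕrep k s % suc k)
  windowℤ-extendPeriodically {M} {k} {g} period s = tabulate-cong λ q → begin
    g (ℕrep k (s ℤ.+ + toℕ q) % K) ≡⟨ cong g (ℕrep-+ k s (toℕ q)) ⟩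
    g ((r + toℕ q) % K)            ≡⟨ cong g ([m%n+o]%n≡[m+o]%n r K (toℕ q)) ⟨
    g ((r % K + toℕ q) % K)        ≡⟨ periodic-mod period (+-mono-<-≤ (m%n<n r K) (FinP.toℕ≤pred[n] q)) ⟩
    g (r % K + toℕ q)              ∎
    where
    K = suc k
    r = ℕrep k s

code : ∀ {p} → (ℕ → Fin p) → (n : ℕ) → Fin (p ^ n)
code g zero    = Fin.zero
code g (suc n) = combine (g 0) (code (g ∘ suc) n)

code-injective : ∀ {p} {g h : ℕ → Fin p} {n} → code g n ≡ code h n → applyUpTo g n ≡ applyUpTo h n
code-injective {n = zero}  _  = refl
code-injective {n = suc n} eq with FinP.combine-injective _ _ _ _ eq
... | head≡ , tail≡ = cong₂ _∷_ head≡ (code-injective tail≡)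

module _ {p M : ℕ} (f : Vec (Fin p) (suc M) → Fin p) where

  SameWindows : (g h : ℕ → Fin p) → Set
  SameWindows g h = ∀ a → f (window g a) ≡ f (window h a)

  sameWindows-shift : ∀ {g h} a → SameWindows g h → SameWindows (shift a g) (shift a h)
  sameWindows-shift {g} {h} a same b = begin
    f (window (shift a g) b) ≡⟨ cong f (window-shift g a b) ⟩
    f (window g (a + b))     ≡⟨ same (a + b) ⟩
    f (window h (a + b))     ≡⟨ cong f (window-shift h a b) ⟨
    f (window (shift a h) b) ∎

  successor-cong : ∀ {g h} → SameWindows g h → ∀ K →
    successor f (applyUpTo g (K + M)) ≡ successor f (applyUpTo h (K + M))
  successor-cong {g} {h} same K = begin
    successor f (applyUpTo g (K + M)) ≡⟨ successor-applyUpTo f g K ⟩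
    applyUpTo (f ∘ window g) K        ≡⟨ applyUpTo-cong K (λ {a} _ → same a) ⟩
    applyUpTo (f ∘ window h) K        ≡⟨ successor-applyUpTo f h K ⟨
    successor f (applyUpTo h (K + M)) ∎

  length-successor : ∀ d xs {K} → length xs ≡ K + M → length (successor f xs) ≡ K
  length-successor d xs {K} eq = begin
    length (successor f xs)
      ≡⟨ cong (length ∘ successor f) (applyUpTo-lookupOr d xs eq) ⟨
    length (successor f (applyUpTo (lookupOr d xs) (K + M)))
      ≡⟨ cong length (successor-applyUpTo f _ K) ⟩
    length (applyUpTo (f ∘ window (lookupOr d xs)) K)
      ≡⟨ length-applyUpTo _ K ⟩
    K ∎

  successor-≡⇒windows : ∀ d α β {K} → length α ≡ K + M → length β ≡ K + M →
    successor f α ≡ successor f β →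
    ∀ {t} → t < K → f (window (lookupOr d α) t) ≡ f (window (lookupOr d β) t)
  successor-≡⇒windows d α β {K} lα lβ eq = applyUpTo-≡⇒ (begin
    applyUpTo (f ∘ window (lookupOr d α)) K         ≡⟨ successor-applyUpTo f _ K ⟨
    successor f (applyUpTo (lookupOr d α) (K + M)) ≡⟨ cong (successor f) (applyUpTo-lookupOr d α lα) ⟩
    successor f α                                   ≡⟨ eq ⟩
    successor f β                                   ≡⟨ cong (successor f) (applyUpTo-lookupOr d β lβ) ⟨
    successor f (applyUpTo (lookupOr d β) (K + M)) ≡⟨ successor-applyUpTo f _ K ⟩
    applyUpTo (f ∘ window (lookupOr d β)) K         ∎)

  sucM≤⇒≡suc+M : ∀ {n} → suc M ≤ n → ∃ λ k → n ≡ suc k + M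
  sucM≤⇒≡suc+M le with m≤n⇒∃[o]m+o≡n le
  ... | k , eqk = k , trans (sym eqk) (cong suc (+-comm M k))

  successor-≡⇒equal-lengths : ∀ d α β → suc M ≤ length α → suc M ≤ length β →
    successor f α ≡ successor f β → ∃ λ k → length α ≡ suc k + M × length β ≡ suc k + M
  successor-≡⇒equal-lengths d α β lα lβ eq with sucM≤⇒≡suc+M lα | sucM≤⇒≡suc+M lβ
  ... | k , eqα | k′ , eqβ = k , eqα , trans eqβ (cong (_+ M) (sym k≡k′))
    where
    k≡k′ : suc k ≡ suc k′
    k≡k′ = trans (sym (length-successor d α eqα)) (trans (cong length eq) (length-successor d β eqβ))

  -- Local configurations give distinct configurations with equal images

  -- A window meeting a difference at t ∈ [M, K) starts at some t ∸ q ∈ [0, K).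
  differing-inside⇒sameWindowsℤ : ∀ (c d : ℤ → Fin p) {K} →
    (∀ i → c i ≢ d i → ∃ λ t → i ≡ + t × M ≤ t × t < K) →
    (∀ {n} → n < K → f (windowℤ c (+ n)) ≡ f (windowℤ d (+ n))) →
    ∀ s → f (windowℤ c s) ≡ f (windowℤ d s)
  differing-inside⇒sameWindowsℤ c d support inside s
    with FinP.all? (λ q → c (s ℤ.+ + toℕ q) Fin.≟ d (s ℤ.+ + toℕ q))
  ... | yes all = cong f (tabulate-cong all)
  ... | no ¬all with FinP.¬∀⟶∃¬ _ _ (λ q → c (s ℤ.+ + toℕ q) Fin.≟ d (s ℤ.+ + toℕ q)) ¬all
  ...   | q , differ with support (s ℤ.+ + toℕ q) differ
  ...     | t , s+q≡t , M≤t , t<K =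
    subst (λ s → f (windowℤ c s) ≡ f (windowℤ d s))
      (sym (i+n≡+m⇒i≡+[m∸n] {s} s+q≡t (≤-trans (FinP.toℕ≤pred[n] q) M≤t)))
      (inside (≤-<-trans (m∸n≤m t (toℕ q)) t<K))

  differing-inside⇒¬injective : ∀ {g h : ℕ → Fin p} {K} →
    (∀ t → g t ≢ h t → M ≤ t × t < K) → (∀ {t} → t < K → f (window g t) ≡ f (window h t)) →
    ¬ (∀ t → g t ≡ h t) → ¬ WindowInjective f
  differing-inside⇒¬injective {g} {h} support inside g≢h inj =
    g≢h (λ t → inj (pad (g 0) g) (pad (g 0) h) (differing-inside⇒sameWindowsℤ _ _ supportℤ inside) (+ t))
    where
    supportℤ : ∀ i → pad (g 0) g i ≢ pad (g 0) h i → ∃ λ t → i ≡ + t × M ≤ t × t < _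
    supportℤ (+ t)    differ = t , refl , support t differ
    supportℤ -[1+ _ ] differ = contradiction refl differ

  periodic-differing⇒¬injective : ∀ {g h : ℕ → Fin p} {k} →
    (∀ {u} → u < M → g u ≡ g (suc k + u)) → (∀ {u} → u < M → h u ≡ h (suc k + u)) →
    (∀ {t} → t < suc k → f (window g t) ≡ f (window h t)) →
    ¬ (∀ {t} → t < suc k + M → g t ≡ h t) → ¬ WindowInjective f
  periodic-differing⇒¬injective {g} {h} {k} periodG periodH inside g≢h inj = g≢h λ {t} t< → begin
    g t           ≡⟨ periodic-mod periodG t< ⟨
    g (t % suc k) ≡⟨ inj (extendPeriodically k g) (extendPeriodically k h) same (+ t) ⟩
    h (t % suc k) ≡⟨ periodic-mod periodH t< ⟩
    h t           ∎
    where
    same : ∀ s → f (windowℤ (extendPeriodically k g) s) ≡ f (windowℤ (extendPeriodically k h) s)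
    same s = begin
      f (windowℤ (extendPeriodically k g) s) ≡⟨ cong f (windowℤ-extendPeriodically periodG s) ⟩
      f (window g (ℕrep k s % suc k))        ≡⟨ inside (m%n<n (ℕrep k s) (suc k)) ⟩
      f (window h (ℕrep k s % suc k))        ≡⟨ cong f (windowℤ-extendPeriodically periodH s) ⟨
      f (windowℤ (extendPeriodically k h) s) ∎

  2*sucM∸1≡sucM+M : 2 * suc M ∸ 1 ≡ suc M + M
  2*sucM∸1≡sucM+M = trans (+-suc M (M + 0)) (cong (λ x → suc (M + x)) (+-identityʳ M))

  2*sucM∸1≤⇒sucM≤ : ∀ {n} → 2 * suc M ∸ 1 ≤ n → suc M ≤ n
  2*sucM∸1≤⇒sucM≤ {n} le = ≤-trans (m≤m+n (suc M) M) (subst (_≤ n) 2*sucM∸1≡sucM+M le)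

  replaceable⇒¬injective : ∀ {α β} → Replaceable f α β → ¬ WindowInjective f
  replaceable⇒¬injective {[]} (lα , _) with 2*sucM∸1≤⇒sucM≤ lα
  ... | ()
  replaceable⇒¬injective {α@(d ∷ _)} {β} (lα , lβ , α≢β , eqL , eqR , eqS)
    with successor-≡⇒equal-lengths d α β (2*sucM∸1≤⇒sucM≤ lα) (2*sucM∸1≤⇒sucM≤ lβ) eqS
  ... | k , eqα , eqβ =
    differing-inside⇒¬injective support (successor-≡⇒windows d α β eqα eqβ eqS)
      (λ all → α≢β (lookupOr-injective d α β eqα eqβ (λ {t} _ → all t)))
    where
    g = lookupOr d α
    h = lookupOr d β
    agreeLeft : ∀ {t} → t < M → g t ≡ h t
    agreeLeft {t} t<M = begin
      g t                      ≡⟨ lookupOr-take d α t<M ⟨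
      lookupOr d (take M α) t  ≡⟨ cong (λ w → lookupOr d w t) eqL ⟩
      lookupOr d (take M β) t  ≡⟨ lookupOr-take d β t<M ⟩
      h t                      ∎
    drop-α≡drop-β : drop (suc k) α ≡ drop (suc k) β
    drop-α≡drop-β = trans (sym (right≡drop α (suc k) eqα)) (trans eqR (right≡drop β (suc k) eqβ))
    agreeRight : ∀ u → g (suc k + u) ≡ h (suc k + u)
    agreeRight u = begin
      g (suc k + u)                ≡⟨ lookupOr-drop d α (suc k) u ⟨
      lookupOr d (drop (suc k) α) u ≡⟨ cong (λ w → lookupOr d w u) drop-α≡drop-β ⟩
      lookupOr d (drop (suc k) β) u ≡⟨ lookupOr-drop d β (suc k) u ⟩
      h (suc k + u)                ∎
    support : ∀ t → g t ≢ h t → M ≤ t × t < suc k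
    support t differ with M ≤? t | suc k ≤? t
    ... | no  t<M | _        = contradiction (agreeLeft (≰⇒> t<M)) differ
    ... | yes _   | yes k≤t  =
      contradiction (subst (λ x → g x ≡ h x) (m+[n∸m]≡n k≤t) (agreeRight (t ∸ suc k))) differ
    ... | yes M≤t | no  t<k  = M≤t , ≰⇒> t<k

  periodic⇒¬injective : ∀ {α β} → Periodic f α β → ¬ WindowInjective f
  periodic⇒¬injective {[]} (() , _)
  periodic⇒¬injective {α@(d ∷ _)} {β} (lα , lβ , α≢β , perα , perβ , eqS)
    with successor-≡⇒equal-lengths d α β lα lβ eqS
  ... | k , eqα , eqβ =
    periodic-differing⇒¬injective (period α eqα perα) (period β eqβ perβ)
      (successor-≡⇒windows d α β eqα eqβ eqS) (α≢β ∘ lookupOr-injective d α β eqα eqβ)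
    where
    period : ∀ xs → length xs ≡ suc k + M → left M xs ≡ right M xs →
      ∀ {u} → u < M → lookupOr d xs u ≡ lookupOr d xs (suc k + u)
    period xs eq per {u} u<M = begin
      lookupOr d xs u                ≡⟨ lookupOr-take d xs u<M ⟨
      lookupOr d (take M xs) u       ≡⟨ cong (λ w → lookupOr d w u) (trans per (right≡drop xs (suc k) eq)) ⟩
      lookupOr d (drop (suc k) xs) u ≡⟨ lookupOr-drop d xs (suc k) u ⟩
      lookupOr d xs (suc k + u)      ∎

  -- Without local configurations, equal images force equal configurations

  block : (ℕ → Fin p) → ℕ → List (Fin p)
  block g a = applyUpTo (shift a g) M

  block-shift : ∀ g a b → block (shift a g) b ≡ block g (a + b)
  block-shift g a b = applyUpTo-cong M (λ {t} _ → cong g (sym (+-assoc a b t)))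

  unperiodic⇒blocks-agree : ¬ HasPeriodic f → ∀ g h k → SameWindows g h →
    block g 0 ≡ block g (suc k) → block h 0 ≡ block h (suc k) → block g 0 ≡ block h 0
  unperiodic⇒blocks-agree noP g h k same periodG periodH = begin
    applyUpTo g M       ≡⟨ left-applyUpTo g (suc k) ⟨
    left M (word g)     ≡⟨ cong (left M) word-g≡word-h ⟩
    left M (word h)     ≡⟨ left-applyUpTo h (suc k) ⟩
    applyUpTo h M       ∎
    where
    word : (ℕ → Fin p) → List (Fin p)
    word g = applyUpTo g (suc k + M)
    long : ∀ g → suc M ≤ length (word g)
    long g = subst (suc M ≤_) (sym (length-applyUpTo g (suc k + M))) (s≤s (m≤n+m M k))
    periodic : ∀ g → block g 0 ≡ block g (suc k) → left M (word g) ≡ right M (word g)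
    periodic g eq = trans (left-applyUpTo g (suc k)) (trans eq (sym (right-applyUpTo g (suc k))))
    word-g≡word-h : word g ≡ word h
    word-g≡word-h = decidable-stable (≡-dec Fin._≟_ (word g) (word h)) λ g≢h →
      noP (word g , word h , long g , long h , g≢h , periodic g periodG , periodic h periodH ,
           successor-cong {g} {h} same (suc k))

  unreplaceable⇒agree-between : ¬ HasReplaceable f → ∀ g h K → SameWindows g h → M < K →
    block g 0 ≡ block h 0 → block g K ≡ block h K → ∀ {t} → t < K + M → g t ≡ h t
  unreplaceable⇒agree-between noR g h K same M<K agreeL agreeR = applyUpTo-≡⇒ word-g≡word-h
    where
    word : (ℕ → Fin p) → List (Fin p)
    word g = applyUpTo g (K + M)
    long : ∀ g → 2 * suc M ∸ 1 ≤ length (word g)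
    long g = subst₂ _≤_ (sym 2*sucM∸1≡sucM+M) (sym (length-applyUpTo g (K + M))) (+-monoˡ-≤ M M<K)
    word-g≡word-h : word g ≡ word h
    word-g≡word-h = decidable-stable (≡-dec Fin._≟_ (word g) (word h)) λ g≢h →
      noR (word g , word h , long g , long h , g≢h ,
           trans (left-applyUpTo g K) (trans agreeL (sym (left-applyUpTo h K))) ,
           trans (right-applyUpTo g K) (trans agreeR (sym (right-applyUpTo h K))) ,
           successor-cong {g} {h} same K)

  blockCodes : (g h : ℕ → Fin p) → ℕ → Fin (p ^ M * p ^ M)
  blockCodes g h a = combine (code (shift a g) M) (code (shift a h) M)

  blockCodes-injective : ∀ g h {a a′} → blockCodes g h a ≡ blockCodes g h a′ →
    block g a ≡ block g a′ × block h a ≡ block h a′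
  blockCodes-injective g h eq with FinP.combine-injective _ _ _ _ eq
  ... | g≡ , h≡ = code-injective g≡ , code-injective h≡

  -- Two of the positions b, …, b + p ^ M * p ^ M carry the same pair of blocks (pigeonhole),
  -- and the words of g and h between them would form a periodic pair.
  unperiodic⇒blocks-agree-within : ¬ HasPeriodic f → ∀ g h → SameWindows g h →
    ∀ b → ∃ λ t → t ≤ p ^ M * p ^ M × block g (b + t) ≡ block h (b + t)
  unperiodic⇒blocks-agree-within noP g h same b
    with FinP.pigeonhole (n<1+n (p ^ M * p ^ M)) (λ i → blockCodes g h (b + toℕ i))
  ... | i , j , i<j , codes≡ with m≤n⇒∃[o]m+o≡n i<j | blockCodes-injective g h codes≡
  ... | k , i+1+k≡j | g≡ , h≡ =
    toℕ i , FinP.toℕ≤pred[n] i ,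
    unperiodic⇒blocks-agree noP (shift a g) (shift a h) k (sameWindows-shift {g} {h} a same)
      (period g g≡) (period h h≡)
    where
    a = b + toℕ i
    a+1+k≡b+j : a + suc k ≡ b + toℕ j
    a+1+k≡b+j =
      trans (+-assoc b (toℕ i) (suc k)) (cong (λ x → b + x) (trans (+-suc (toℕ i) k) i+1+k≡j))
    period : ∀ g → block g a ≡ block g (b + toℕ j) → block (shift a g) 0 ≡ block (shift a g) (suc k)
    period g eq = trans eq (trans (cong (block g) (sym a+1+k≡b+j)) (sym (block-shift g a (suc k))))

  -- Blocks agree at some tL ≤ N and at M + N + 1 + tR, with position M + N strictly between.
  noLocalConfigs⇒agree : ¬ HasReplaceable f → ¬ HasPeriodic f → ∀ g h → SameWindows g h →
    g (M + p ^ M * p ^ M) ≡ h (M + p ^ M * p ^ M)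
  noLocalConfigs⇒agree noR noP g h same
    with unperiodic⇒blocks-agree-within noP g h same 0
       | unperiodic⇒blocks-agree-within noP g h same (suc (M + p ^ M * p ^ M))
  ... | tL , tL≤N , agreeL | tR , _ , agreeR with m≤n⇒∃[o]m+o≡n tL≤N
  ... | u , tL+u≡N =
    subst (λ x → g x ≡ h x) position
      (unreplaceable⇒agree-between noR (shift tL g) (shift tL h) K
        (sameWindows-shift {g} {h} tL same) M<K agreeL agreeR′ M+u<K+M)
    where
    N = p ^ M * p ^ M
    K = suc (M + u + tR)
    M<K : M < K
    M<K = s≤s (≤-trans (m≤m+n M u) (m≤m+n (M + u) tR))
    M+u<K+M : M + u < K + M
    M+u<K+M = s≤s (≤-trans (m≤m+n (M + u) tR) (m≤m+n (M + u + tR) M))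
    position : tL + (M + u) ≡ M + N
    position = trans (swap tL M u) (cong (λ x → M + x) tL+u≡N)
      where
      swap : ∀ a b c → a + (b + c) ≡ b + (a + c)
      swap = solve-∀
    right-end : tL + K ≡ suc (M + N) + tR
    right-end = trans (rearrange tL M u tR) (cong (λ x → suc (M + x) + tR) tL+u≡N)
      where
      rearrange : ∀ a b c d → a + suc (b + c + d) ≡ suc (b + (a + c)) + d
      rearrange = solve-∀
    agreeR′ : block (shift tL g) K ≡ block (shift tL h) K
    agreeR′ = begin
      block (shift tL g) K          ≡⟨ block-shift g tL K ⟩
      block g (tL + K)              ≡⟨ cong (block g) right-end ⟩
      block g (suc (M + N) + tR)    ≡⟨ agreeR ⟩
      block h (suc (M + N) + tR)    ≡⟨ cong (block h) right-end ⟨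
      block h (tL + K)              ≡⟨ block-shift h tL K ⟨
      block (shift tL h) K          ∎

  noLocalConfigs⇒windowInjective : ¬ HasReplaceable f → ¬ HasPeriodic f → WindowInjective f
  noLocalConfigs⇒windowInjective noR noP c d same i = begin
    c i           ≡⟨ cong c (i-n+n≡i i (+ n)) ⟨
    c (z ℤ.+ + n) ≡⟨ noLocalConfigs⇒agree noR noP (restrict c) (restrict d) sameℕ ⟩
    d (z ℤ.+ + n) ≡⟨ cong d (i-n+n≡i i (+ n)) ⟩
    d i           ∎
    where
    n = M + p ^ M * p ^ M
    z = i ℤ.- + n
    i-n+n≡i : ∀ i n → i ℤ.- n ℤ.+ n ≡ i
    i-n+n≡i = ℤRing.solve-∀
    restrict : (ℤ → Fin p) → ℕ → Fin p
    restrict c t = c (z ℤ.+ + t)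
    sameℕ : SameWindows (restrict c) (restrict d)
    sameℕ a = begin
      f (window (restrict c) a) ≡⟨ cong f (windowℤ-restrict c z a) ⟩
      f (windowℤ c (z ℤ.+ + a)) ≡⟨ same (z ℤ.+ + a) ⟩
      f (windowℤ d (z ℤ.+ + a)) ≡⟨ cong f (windowℤ-restrict d z a) ⟨
      f (window (restrict d) a) ∎

windowInjective⇔noLocalConfigs : ∀ {p m} (f : Vec (Fin p) m → Fin p) → 0 < m →
  WindowInjective f ⇔ (¬ HasReplaceable f × ¬ HasPeriodic f)
windowInjective⇔noLocalConfigs f (s≤s z≤n) = mk⇔
  (λ inj → (λ (_ , _ , rep) → replaceable⇒¬injective f rep inj) ,
           (λ (_ , _ , per) → periodic⇒¬injective f per inj))
  (λ (noR , noP) → noLocalConfigs⇒windowInjective f noR noP)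

theorem1 : (p L R : ℕ) (f : Vec (Fin p) (L + 1 + R) → Fin p) →
    InjectiveGlobal L R f ⇔ ((¬ HasReplaceable f) × (¬ HasPeriodic f))
theorem1 p L R f = ⇔.trans (injectiveGlobal⇔windowInjective L R f)
  (windowInjective⇔noLocalConfigs f (m≤n⇒m≤n+o R (m≤n+m 1 L)))
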